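{- Let $k\ge1$, $a\in\mathbb{C}$, $x_1\in\mathbb{C}$, and write $\mathbf{x}=(x_1,0,\dots,0)\in\mathbb{C}^k$. Define numbers $A^{(k)}_n(a)$ by $A^{(k)}_1(a)=a$ and, for $n\ge0$, $$A^{(k)}_{n+2}(a)=\sum_{i=0}^{n}\binom{kn+k-1}{ki+k-1}A^{(k)}_{n-i+1}(a)A^{(k)}_{i+1}(a).$$ Then (1) $f_{kn+1}(\mathbf{x},a)=f_{kn+2}(\mathbf{x},a)=\cdots=f_{kn+k-1}(\mathbf{x},a)=0$ for all $n\ge0$; (2) $f_{kn}(\mathbf{x},a)=A^{(k)}_n(a)e^{nx_1}$ for all $n\ge1$.
   Context: The complete exponential Bell polynomials $B_n$ are defined by $\exp\left(\sum_{m\ge1}y_mt^m/m!\right)=\sum_{n\ge0}B_n(y_1,\dots,y_n)t^n/n!$. For $\mathbf{x}=(x_1,\dots,x_k)$ the complete exponential autonomous functions of order $k$ are defined by $f_j(\mathbf{x},a)=x_{j+1}$ for $0\le j\le k-1$, $f_k(\mathbf{x},a)=ae^{x_1}$, and $f_{n+k}(\mathbf{x},a)=ae^{x_1}B_n(f_1(\mathbf{x},a),\dots,f_n(\mathbf{x},a))$ for $n\ge1$. -}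

module Defs where

open import Level using (Level)
open import Algebra.Bundles using (CommutativeRing)
open import Data.Nat using (ℕ; zero; suc; _∸_; _<?_)
import Data.Nat as N
open import Data.Nat.Combinatorics using (_C_)
open import Data.Fin using (Fin; fromℕ<)
import Data.Fin as F
open import Relation.Nullary using (yes; no)
import Algebra.Definitions.RawMonoid as RM

module _ {c ℓ : Level} (R : CommutativeRing c ℓ) where
  open CommutativeRing R

  natMul : ℕ → Carrier → Carrier
  natMul = RM._×_ +-rawMonoid

  binom : ℕ → ℕ → Carrier
  binom n i = natMul (n C i) 1#

  sumTo : ℕ → (ℕ → Carrier) → Carrier
  sumTo zero    g = 0#
  sumTo (suc n) g = sumTo n g + g n

  -- Complete exponential Bell polynomials B_n(y_1,...,y_n), via the standard
  -- recurrence B_0 = 1, B_{n+1} = Σ_{i=0}^{n} C(n,i) B_{n-i} y_{i+1}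
  -- (first argument is fuel; B_n uses fuel n, which suffices).
  bellF : ℕ → ℕ → (ℕ → Carrier) → Carrier
  bellF _        zero    y = 1#
  bellF zero     (suc n) y = 0#
  bellF (suc fu) (suc n) y =
    sumTo (suc n) (λ i → binom n i * bellF fu (n ∸ i) y * y (suc i))

  bell : ℕ → (ℕ → Carrier) → Carrier
  bell n y = bellF n n y

  first : ∀ {k} → (Fin k → Carrier) → Carrier
  first {zero}  x = 0#
  first {suc k} x = x F.zero

  -- complete exponential autonomous functions f_j(x, a), with fuel;
  -- f_j = x_{j+1} (j < k), f_k = a e^{x_1}, f_{n+k} = a e^{x_1} B_n(f_1,...,f_n)
  autF : (exp : Carrier → Carrier) (k : ℕ) (x : Fin k → Carrier) (a : Carrier)
       → ℕ → ℕ → Carrier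
  autF exp k x a zero       j = 0#
  autF exp k x a (suc fuel) j with j <? k
  ... | yes p = x (fromℕ< p)
  ... | no _ with j ∸ k
  ...   | zero  = a * exp (first x)
  ...   | suc n = a * exp (first x) * bell (suc n) (autF exp k x a fuel)

  aut : (exp : Carrier → Carrier) (k : ℕ) (x : Fin k → Carrier) (a : Carrier)
      → ℕ → Carrier
  aut exp k x a j = autF exp k x a (suc j) j

  xvec : (k : ℕ) → Carrier → Fin k → Carrier
  xvec (suc k) x₁ F.zero    = x₁
  xvec (suc k) x₁ (F.suc i) = 0#

  -- A^{(k)}_n(a): A_1 = a,
  -- A_{n+2} = Σ_{i=0}^{n} C(kn+k-1, ki+k-1) A_{n-i+1} A_{i+1}
  -- (first argument is fuel; A_0 is not defined by the paper, set to 0 here, unused)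
  AF : (k : ℕ) (a : Carrier) → ℕ → ℕ → Carrier
  AF k a _        zero          = 0#
  AF k a _        (suc zero)    = a
  AF k a zero     (suc (suc n)) = 0#
  AF k a (suc fu) (suc (suc n)) =
    sumTo (suc n) (λ i → binom (k N.* n N.+ k ∸ 1) (k N.* i N.+ k ∸ 1)
                         * AF k a fu (n ∸ i N.+ 1) * AF k a fu (i N.+ 1))

  A : (k : ℕ) (a : Carrier) → ℕ → Carrier
  A k a n = AF k a n n

{-# OPTIONS --safe #-}
module Submission where

-- Since a e^{x₁} B₀ = a e^{x₁} = f_k, the Bell recurrence B_{n+1}(y) = Σᵢ C(n,i) B_{n-i}(y) y_{i+1}
-- turns the definition into f_{n+1+k} = Σ_{i=0}^{n} C(n,i) f_{n-i+k} f_{i+1}. At x = (x₁,0,…,0)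
-- every initial value vanishes except f_k = a e^{x₁}. The indices n-i+k and i+1 of a summand add
-- up to n+1+k, so if k ∤ n+1+k one of them is not a multiple of k, and by strong induction every
-- summand vanishes; this is (1). If n+1+k = k(Q+2), then by (1) only the summands with
-- i+1 = k(j+1) survive, and by induction they are C(kQ+k-1, kj+k-1) A_{Q-j+1} A_{j+1} e^{(Q+2)x₁},
-- which add up to A_{Q+2} e^{(Q+2)x₁}.

open import Defs
open import Algebra.Bundles using (CommutativeRing)
open import Data.Nat using (ℕ; zero; suc; _≤_; _<_; _∸_; _<?_; z≤n; s≤s)
import Data.Nat as N
open import Data.Product using (_×_; _,_)
open import Data.Nat.Divisibility using (_∣_; _∣?_; _∣0; ∣-refl; ∣⇒≤; m∣m*n; ∣m∣n⇒∣m+n; ∣m+n∣m⇒∣n)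
import Data.Nat.Properties as NP
open import Data.Nat.Induction using (<-rec)
open import Data.Nat.Tactic.RingSolver using (solve-∀)
open import Data.Fin using (Fin; fromℕ<)
open import Data.Empty using (⊥-elim)
open import Function using (_∘_)
open import Relation.Nullary using (¬_; yes; no)
import Relation.Binary.PropositionalEquality as P
open P using (_≡_)
import Algebra.Properties.Monoid.Mult as Mult
import Algebra.Properties.CommutativeSemigroup as CommSemigroupProperties
import Relation.Binary.Reasoning.Setoid as SetoidReasoning

data Stage (k : ℕ) : ℕ → Set where
  initial : ∀ {t} → t < k → Stage k t
  base    : Stage k k
  later   : ∀ n → Stage k (suc n N.+ k)

stage : ∀ k t → Stage k t
stage k t with t <? k
... | yes t<k = initial t<k
... | no t≮k with t ∸ k | NP.m∸n+n≡m (NP.≮⇒≥ t≮k)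
...   | zero  | P.refl = base
...   | suc n | P.refl = later n

m∤m*n+o : ∀ m n {o} → 0 < o → o < m → ¬ m ∣ m N.* n N.+ o
m∤m*n+o m n {suc o} _ o<m m∣m*n+o =
  NP.<⇒≱ o<m (∣⇒≤ (∣m+n∣m⇒∣n m∣m*n+o (m∣m*n n)))

-- With k = suc k', the index k x + k' = k x + k - 1 is the last one of the x-th block of k
-- consecutive indices.
block-end-suc : ∀ k' x → suc (suc k' N.* x N.+ k') ≡ suc k' N.* suc x
block-end-suc = solve-∀

block-end-later : ∀ k' x → suc (suc k' N.* x N.+ k') N.+ suc k' ≡ suc k' N.* suc (suc x)
block-end-later = solve-∀

block-end-complement : ∀ k' x y →
  suc k' N.* x N.+ k' ∸ (suc k' N.* y N.+ k') N.+ suc k' ≡ suc k' N.* suc (x ∸ y)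
block-end-complement k' x y = begin
  k N.* x N.+ k' ∸ (k N.* y N.+ k') N.+ k
    ≡⟨ P.cong₂ (λ u v → u ∸ v N.+ k) (NP.+-comm (k N.* x) k') (NP.+-comm (k N.* y) k') ⟩
  k' N.+ k N.* x ∸ (k' N.+ k N.* y) N.+ k
    ≡⟨ P.cong (N._+ k) (NP.[m+n]∸[m+o]≡n∸o k' (k N.* x) (k N.* y)) ⟩
  k N.* x ∸ k N.* y N.+ k
    ≡⟨ P.cong (N._+ k) (NP.*-distribˡ-∸ k x y) ⟨
  k N.* (x ∸ y) N.+ k
    ≡⟨ P.trans (NP.+-comm (k N.* (x ∸ y)) k) (P.sym (NP.*-suc k (x ∸ y))) ⟩
  k N.* suc (x ∸ y) ∎
  where
  open P.≡-Reasoning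
  k = suc k'

[n∸i+k]+[1+i]≡1+n+k : ∀ {n i} k → i ≤ n → n ∸ i N.+ k N.+ suc i ≡ suc n N.+ k
[n∸i+k]+[1+i]≡1+n+k {n} {i} k i≤n =
  P.trans (rearrange (n ∸ i) i k) (P.cong (λ m → suc m N.+ k) (NP.m∸n+n≡m i≤n))
  where
  rearrange : ∀ m i k → m N.+ k N.+ suc i ≡ suc (m N.+ i) N.+ k
  rearrange = solve-∀

module _ {c ℓ} (R : CommutativeRing c ℓ) where
  open CommutativeRing R hiding (zero)
  open SetoidReasoning setoid
  open CommSemigroupProperties *-commutativeSemigroup using (x∙yz≈y∙xz; interchange)

  sumTo-cong : ∀ n {g h : ℕ → Carrier} → (∀ i → i < n → g i ≈ h i) →
               sumTo R n g ≈ sumTo R n h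
  sumTo-cong zero    _   = refl
  sumTo-cong (suc n) g≈h = +-cong (sumTo-cong n (λ i → g≈h i ∘ NP.m<n⇒m<1+n)) (g≈h n NP.≤-refl)

  sumTo-zero : ∀ n {g : ℕ → Carrier} → (∀ i → i < n → g i ≈ 0#) → sumTo R n g ≈ 0#
  sumTo-zero zero    _   = refl
  sumTo-zero (suc n) g≈0 =
    trans (+-cong (sumTo-zero n (λ i → g≈0 i ∘ NP.m<n⇒m<1+n)) (g≈0 n NP.≤-refl)) (+-identityˡ 0#)

  sumTo-+ : ∀ m n (g : ℕ → Carrier) →
            sumTo R (m N.+ n) g ≈ sumTo R m g + sumTo R n (λ i → g (m N.+ i))
  sumTo-+ m zero    g = begin
    sumTo R (m N.+ zero) g ≡⟨ P.cong (λ l → sumTo R l g) (NP.+-identityʳ m) ⟩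
    sumTo R m g            ≈⟨ +-identityʳ _ ⟨
    sumTo R m g + 0#       ∎
  sumTo-+ m (suc n) g = begin
    sumTo R (m N.+ suc n) g
      ≡⟨ P.cong (λ l → sumTo R l g) (NP.+-suc m n) ⟩
    sumTo R (m N.+ n) g + g (m N.+ n)
      ≈⟨ +-congʳ (sumTo-+ m n g) ⟩
    sumTo R m g + sumTo R n (λ i → g (m N.+ i)) + g (m N.+ n)
      ≈⟨ +-assoc _ _ _ ⟩
    sumTo R m g + (sumTo R n (λ i → g (m N.+ i)) + g (m N.+ n)) ∎

  sumTo-*ˡ : ∀ n (g : ℕ → Carrier) u → u * sumTo R n g ≈ sumTo R n (λ i → u * g i)
  sumTo-*ˡ zero    g u = zeroʳ u
  sumTo-*ˡ (suc n) g u = trans (distribˡ u _ _) (+-congʳ (sumTo-*ˡ n g u))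

  sumTo-*ʳ : ∀ n (g : ℕ → Carrier) u → sumTo R n g * u ≈ sumTo R n (λ i → g i * u)
  sumTo-*ʳ zero    g u = zeroˡ u
  sumTo-*ʳ (suc n) g u = trans (distribʳ u _ _) (+-congʳ (sumTo-*ʳ n g u))

  sumTo-sparse : ∀ k' M {g : ℕ → Carrier} →
                 (∀ j s → s < k' → g (suc k' N.* j N.+ s) ≈ 0#) →
                 sumTo R (suc k' N.* M) g ≈ sumTo R M (λ j → g (suc k' N.* j N.+ k'))
  sumTo-sparse k' zero    {g} _   = reflexive (P.cong (λ l → sumTo R l g) (NP.*-zeroʳ (suc k')))
  sumTo-sparse k' (suc M) {g} off = begin
    sumTo R (k N.* suc M) g
      ≡⟨ P.cong (λ l → sumTo R l g) (P.trans (NP.*-suc k M) (NP.+-comm k (k N.* M))) ⟩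
    sumTo R (k N.* M N.+ k) g
      ≈⟨ sumTo-+ (k N.* M) k g ⟩
    sumTo R (k N.* M) g + (sumTo R k' (λ s → g (k N.* M N.+ s)) + g (k N.* M N.+ k'))
      ≈⟨ +-cong (sumTo-sparse k' M off) (+-congʳ (sumTo-zero k' (λ s → off M s))) ⟩
    sumTo R M (λ j → g (k N.* j N.+ k')) + (0# + g (k N.* M N.+ k'))
      ≈⟨ +-congˡ (+-identityˡ _) ⟩
    sumTo R (suc M) (λ j → g (k N.* j N.+ k')) ∎
    where
    k = suc k'

  bellF-cong : ∀ fu m {y y' : ℕ → Carrier} → (∀ i → 1 ≤ i → i ≤ m → y i ≈ y' i) →
               bellF R fu m y ≈ bellF R fu m y'
  bellF-cong _        zero    _    = refl
  bellF-cong zero     (suc m) _    = refl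
  bellF-cong (suc fu) (suc n) y≈y' = sumTo-cong (suc n) λ i i≤n →
    *-cong (*-congˡ (bellF-cong fu (n ∸ i) λ j 1≤j j≤n∸i →
                      y≈y' j 1≤j (NP.m≤n⇒m≤1+n (NP.≤-trans j≤n∸i (NP.m∸n≤m n i)))))
           (y≈y' (suc i) (s≤s z≤n) i≤n)

  bellF-fuel : ∀ fu fu' m {y : ℕ → Carrier} → m ≤ fu → m ≤ fu' →
               bellF R fu m y ≈ bellF R fu' m y
  bellF-fuel _        _         zero    _         _          = refl
  bellF-fuel (suc fu) (suc fu') (suc n) (s≤s n≤fu) (s≤s n≤fu') = sumTo-cong (suc n) λ i _ →
    *-congʳ (*-congˡ (bellF-fuel fu fu' (n ∸ i) (NP.≤-trans (NP.m∸n≤m n i) n≤fu)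
                                               (NP.≤-trans (NP.m∸n≤m n i) n≤fu')))

  AF-fuel : ∀ k a fu fu' m → m ≤ fu → m ≤ fu' → AF R k a fu m ≈ AF R k a fu' m
  AF-fuel k a _        _         zero          _          _           = refl
  AF-fuel k a _        _         (suc zero)    _          _           = refl
  AF-fuel k a (suc fu) (suc fu') (suc (suc n)) (s≤s n<fu) (s≤s n<fu') =
    sumTo-cong (suc n) λ i i≤n →
      *-cong (*-congˡ (AF-fuel k a fu fu' (n ∸ i N.+ 1) (NP.≤-trans (n∸i+1≤1+n i) n<fu)
                                                          (NP.≤-trans (n∸i+1≤1+n i) n<fu')))
             (AF-fuel k a fu fu' (i N.+ 1) (NP.≤-trans (i+1≤1+n i≤n) n<fu)
                                           (NP.≤-trans (i+1≤1+n i≤n) n<fu'))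
    where
    n∸i+1≤1+n : ∀ i → n ∸ i N.+ 1 ≤ suc n
    n∸i+1≤1+n i = P.subst (n ∸ i N.+ 1 ≤_) (NP.+-comm n 1) (NP.+-monoˡ-≤ 1 (NP.m∸n≤m n i))
    i+1≤1+n : ∀ {i} → i < suc n → i N.+ 1 ≤ suc n
    i+1≤1+n {i} = P.subst (N._≤ suc n) (NP.+-comm 1 i)

  A-summand : ℕ → Carrier → ℕ → ℕ → Carrier
  A-summand k' a n i = binom R (suc k' N.* n N.+ k') (suc k' N.* i N.+ k')
                       * A R (suc k') a (suc (n ∸ i)) * A R (suc k') a (suc i)

  A-recurrence : ∀ k' a n → A R (suc k') a (suc (suc n)) ≈ sumTo R (suc n) (A-summand k' a n)
  A-recurrence k' a n = sumTo-cong (suc n) λ i i≤n →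
    *-cong (*-cong (reflexive (P.cong₂ (binom R) (pred-block-end n) (pred-block-end i)))
                   (AF≈A (n ∸ i) (s≤s (NP.m∸n≤m n i))))
           (AF≈A i i≤n)
    where
    k = suc k'
    pred-block-end : ∀ x → k N.* x N.+ k ∸ 1 ≡ k N.* x N.+ k'
    pred-block-end x = P.cong (_∸ 1) (NP.+-suc (k N.* x) k')
    AF≈A : ∀ m → m < suc n → AF R k a (suc n) (m N.+ 1) ≈ A R k a (suc m)
    AF≈A m m<1+n = trans (reflexive (P.cong (AF R k a (suc n)) (NP.+-comm m 1)))
                         (AF-fuel k a (suc n) (suc m) (suc m) m<1+n NP.≤-refl)

  module Autonomous (exp : Carrier → Carrier) (k' : ℕ) (x : Fin (suc k') → Carrier) (a : Carrier) where
    k : ℕ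
    k = suc k'

    af : ℕ → ℕ → Carrier
    af = autF R exp k x a

    f : ℕ → Carrier
    f = aut R exp k x a

    ae : Carrier
    ae = a * exp (first R x)

    autF-fuel : ∀ fu fu' j → j < fu → j < fu' → af fu j ≈ af fu' j
    autF-fuel (suc fu) (suc fu') j (s≤s j≤fu) (s≤s j≤fu') with j <? k
    ... | yes _   = refl
    ... | no j≮k with j ∸ k | NP.∸-monoʳ-< (s≤s z≤n) (NP.≮⇒≥ j≮k)
    ...   | zero  | _     = refl
    ...   | suc n | 1+n<j = *-congˡ (bellF-cong (suc n) (suc n) λ i _ i≤1+n →
            autF-fuel fu fu' i (below i≤1+n j≤fu) (below i≤1+n j≤fu'))
      where
      below : ∀ {i b} → i ≤ suc n → j ≤ b → i < b
      below i≤1+n j≤b = NP.<-≤-trans (NP.≤-<-trans i≤1+n 1+n<j) j≤b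

    aut-initial : ∀ {j} (j<k : j < k) → f j ≈ x (fromℕ< j<k)
    aut-initial {j} j<k with j <? k
    ... | yes _  = refl
    ... | no j≮k = ⊥-elim (j≮k j<k)

    aut-base : f k ≈ ae
    aut-base with k <? k
    ... | yes k<k = ⊥-elim (NP.n≮n k k<k)
    ... | no _ with k ∸ k | NP.n∸n≡0 k
    ...   | _ | P.refl = refl

    aut-later : ∀ n → f (suc n N.+ k) ≈ ae * bell R (suc n) f
    aut-later n with suc n N.+ k <? k
    ... | yes n+k<k = ⊥-elim (NP.m+n≮n (suc n) k n+k<k)
    ... | no _ with suc n N.+ k ∸ k | NP.m+n∸n≡m (suc n) k
    ...   | _ | P.refl = *-congˡ (bellF-cong (suc n) (suc n) λ i _ i≤1+n →
            autF-fuel _ _ i (NP.≤-<-trans i≤1+n (NP.m<m+n (suc n) (s≤s z≤n))) (NP.n<1+n i))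

    ae*bell : ∀ m → ae * bell R m f ≈ f (m N.+ k)
    ae*bell zero    = trans (*-identityʳ ae) (sym aut-base)
    ae*bell (suc m) = sym (aut-later m)

    summand : ℕ → ℕ → Carrier
    summand n i = binom R n i * f (n ∸ i N.+ k) * f (suc i)

    aut-recurrence : ∀ n → f (suc n N.+ k) ≈ sumTo R (suc n) (summand n)
    aut-recurrence n = begin
      f (suc n N.+ k)
        ≈⟨ aut-later n ⟩
      ae * bell R (suc n) f
        ≈⟨ sumTo-*ˡ (suc n) _ ae ⟩
      sumTo R (suc n) (λ i → ae * (binom R n i * bellF R n (n ∸ i) f * f (suc i)))
        ≈⟨ sumTo-cong (suc n) (λ i _ → term i) ⟩
      sumTo R (suc n) (summand n) ∎
      where
      term : ∀ i → ae * (binom R n i * bellF R n (n ∸ i) f * f (suc i)) ≈ summand n i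
      term i = begin
        ae * (binom R n i * bellF R n (n ∸ i) f * f (suc i))
          ≈⟨ *-assoc _ _ _ ⟨
        ae * (binom R n i * bellF R n (n ∸ i) f) * f (suc i)
          ≈⟨ *-congʳ (x∙yz≈y∙xz ae _ _) ⟩
        binom R n i * (ae * bellF R n (n ∸ i) f) * f (suc i)
          ≈⟨ *-congʳ (*-congˡ (*-congˡ (bellF-fuel n _ _ (NP.m∸n≤m n i) NP.≤-refl))) ⟩
        binom R n i * (ae * bell R (n ∸ i) f) * f (suc i)
          ≈⟨ *-congʳ (*-congˡ (ae*bell (n ∸ i))) ⟩
        binom R n i * f (n ∸ i N.+ k) * f (suc i) ∎

    f-suc≈0⇒summand≈0 : ∀ n {i} → f (suc i) ≈ 0# → summand n i ≈ 0#
    f-suc≈0⇒summand≈0 n f≈0 = trans (*-congˡ f≈0) (zeroʳ _)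

    f-complement≈0⇒summand≈0 : ∀ n {i} → f (n ∸ i N.+ k) ≈ 0# → summand n i ≈ 0#
    f-complement≈0⇒summand≈0 n f≈0 = trans (*-congʳ (trans (*-congˡ f≈0) (zeroʳ _))) (zeroˡ _)

  module FirstAxis (exp : Carrier → Carrier) (exp-cong : ∀ {u v} → u ≈ v → exp u ≈ exp v)
      (exp-+ : ∀ u v → exp (u + v) ≈ exp u * exp v) (k' : ℕ) (a x₁ : Carrier) where
    open Autonomous exp k' (xvec R (suc k') x₁) a

    E : ℕ → Carrier
    E q = exp (natMul R q x₁)

    E-+ : ∀ m n → E (m N.+ n) ≈ E m * E n
    E-+ m n = trans (exp-cong (Mult.×-homo-+ +-monoid x₁ m n)) (exp-+ _ _)

    aut-initial-vanishes : ∀ {t} → t < k → ¬ k ∣ t → f t ≈ 0#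
    aut-initial-vanishes {zero}  _   k∤0 = ⊥-elim (k∤0 (k ∣0))
    aut-initial-vanishes {suc t} t<k _   = aut-initial t<k

    aut-off-multiple : ∀ t → ¬ k ∣ t → f t ≈ 0#
    aut-off-multiple = <-rec _ step
      where
      step : ∀ t → (∀ {s} → s < t → ¬ k ∣ s → f s ≈ 0#) → ¬ k ∣ t → f t ≈ 0#
      step t IH k∤t with stage k t
      ... | initial t<k = aut-initial-vanishes t<k k∤t
      ... | base        = ⊥-elim (k∤t ∣-refl)
      ... | later n     = trans (aut-recurrence n) (sumTo-zero (suc n) summand-vanishes)
        where
        summand-vanishes : ∀ i → i < suc n → summand n i ≈ 0#
        summand-vanishes i (s≤s i≤n) with k ∣? suc i
        ... | no k∤1+i  =
          f-suc≈0⇒summand≈0 n (IH (NP.≤-<-trans (s≤s i≤n) (NP.m<m+n (suc n) (s≤s z≤n))) k∤1+i)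
        ... | yes k∣1+i =
          f-complement≈0⇒summand≈0 n (IH (NP.+-monoˡ-< k (s≤s (NP.m∸n≤m n i))) k∤n∸i+k)
          where
          k∤n∸i+k : ¬ k ∣ n ∸ i N.+ k
          k∤n∸i+k k∣n∸i+k =
            k∤t (P.subst (k ∣_) ([n∸i+k]+[1+i]≡1+n+k k i≤n) (∣m∣n⇒∣m+n k∣n∸i+k k∣1+i))

    summand-off-grid : ∀ n j s → s < k' → summand n (k N.* j N.+ s) ≈ 0#
    summand-off-grid n j s s<k' = f-suc≈0⇒summand≈0 n (aut-off-multiple _ k∤1+i)
      where
      k∤1+i : ¬ k ∣ suc (k N.* j N.+ s)
      k∤1+i = P.subst (¬_ ∘ (k ∣_)) (NP.+-suc (k N.* j) s) (m∤m*n+o k j (s≤s z≤n) (s≤s s<k'))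

    ClosedForm : ℕ → Set ℓ
    ClosedForm q = f (k N.* suc q) ≈ A R k a (suc q) * E (suc q)

    summand-on-grid : ∀ Q → (∀ {j} → j < suc Q → ClosedForm j) →
      ∀ j → j < suc Q →
      summand (k N.* Q N.+ k') (k N.* j N.+ k') ≈ A-summand k' a Q j * E (suc (suc Q))
    summand-on-grid Q closed j (s≤s j≤Q) = begin
      b * f (k N.* Q N.+ k' ∸ (k N.* j N.+ k') N.+ k) * f (suc (k N.* j N.+ k'))
        ≡⟨ P.cong₂ (λ u v → b * f u * f v) (block-end-complement k' Q j) (block-end-suc k' j) ⟩
      b * f (k N.* suc (Q ∸ j)) * f (k N.* suc j)
        ≈⟨ *-cong (*-congˡ (closed (s≤s (NP.m∸n≤m Q j)))) (closed (s≤s j≤Q)) ⟩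
      b * (A R k a (suc (Q ∸ j)) * E (suc (Q ∸ j))) * (A R k a (suc j) * E (suc j))
        ≈⟨ *-congʳ (*-assoc _ _ _) ⟨
      b * A R k a (suc (Q ∸ j)) * E (suc (Q ∸ j)) * (A R k a (suc j) * E (suc j))
        ≈⟨ interchange _ _ _ _ ⟩
      A-summand k' a Q j * (E (suc (Q ∸ j)) * E (suc j))
        ≈⟨ *-congˡ (E-+ (suc (Q ∸ j)) (suc j)) ⟨
      A-summand k' a Q j * E (suc (Q ∸ j) N.+ suc j)
        ≡⟨ P.cong (λ m → A-summand k' a Q j * E (suc m))
                  (P.trans (NP.+-suc (Q ∸ j) j) (P.cong suc (NP.m∸n+n≡m j≤Q))) ⟩
      A-summand k' a Q j * E (suc (suc Q)) ∎
      where
      b = binom R (k N.* Q N.+ k') (k N.* j N.+ k')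

    aut-multiple : ∀ q → ClosedForm q
    aut-multiple = <-rec _ step
      where
      step : ∀ q → (∀ {j} → j < q → ClosedForm j) → ClosedForm q
      step zero    _      = begin
        f (k N.* 1)  ≡⟨ P.cong f (NP.*-identityʳ k) ⟩
        f k          ≈⟨ aut-base ⟩
        a * exp x₁   ≈⟨ *-congˡ (exp-cong (Mult.×-homo-1 +-monoid x₁)) ⟨
        a * E 1      ∎
      step (suc Q) closed = begin
        f (k N.* suc (suc Q))
          ≡⟨ P.cong f (block-end-later k' Q) ⟨
        f (suc n N.+ k)
          ≈⟨ aut-recurrence n ⟩
        sumTo R (suc n) (summand n)
          ≡⟨ P.cong (λ l → sumTo R l (summand n)) (block-end-suc k' Q) ⟩
        sumTo R (k N.* suc Q) (summand n)
          ≈⟨ sumTo-sparse k' (suc Q) (summand-off-grid n) ⟩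
        sumTo R (suc Q) (λ j → summand n (k N.* j N.+ k'))
          ≈⟨ sumTo-cong (suc Q) (summand-on-grid Q closed) ⟩
        sumTo R (suc Q) (λ j → A-summand k' a Q j * E (suc (suc Q)))
          ≈⟨ sumTo-*ʳ (suc Q) (A-summand k' a Q) _ ⟨
        sumTo R (suc Q) (A-summand k' a Q) * E (suc (suc Q))
          ≈⟨ *-congʳ (A-recurrence k' a Q) ⟨
        A R k a (suc (suc Q)) * E (suc (suc Q)) ∎
        where
        n = k N.* Q N.+ k'

mainTheorem3 : ∀ {c ℓ} (R : CommutativeRing c ℓ)
    → let open CommutativeRing R in
      (exp : Carrier → Carrier)
    → (∀ {u v} → u ≈ v → exp u ≈ exp v)
    → (∀ u v → exp (u + v) ≈ (exp u * exp v))
    → exp 0# ≈ 1#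
    → (k : ℕ) → 1 ≤ k → (a x₁ : Carrier)
    → ((n r : ℕ) → 1 ≤ r → r < k
         → aut R exp k (xvec R k x₁) a (k N.* n N.+ r) ≈ 0#)
      × ((n : ℕ) → 1 ≤ n
         → aut R exp k (xvec R k x₁) a (k N.* n) ≈ (A R k a n * exp (natMul R n x₁)))
mainTheorem3 R exp exp-cong exp-+ _ (suc k') _ a x₁ =
  (λ n r 0<r r<k → aut-off-multiple (suc k' N.* n N.+ r) (m∤m*n+o (suc k') n 0<r r<k)) ,
  (λ { (suc q) _ → aut-multiple q })
  where
  open FirstAxis R exp exp-cong exp-+ k' a x₁
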